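{- For every path $P$ (a graph isomorphic to $P_n$, the path on $n\ge 1$ vertices), $\varphi_t(P)=m_t(P)$.
   Context: Let $G=(V,E)$ be a simple undirected graph. An element of $G$ is a member of $V\cup E$. Two elements $x,y$ are adjacent if (i) $x,y\in V$ and $(x,y)\in E$, or (ii) one is a vertex and the other an edge having it as an endpoint, or (iii) $x,y\in E$ are distinct edges sharing an endpoint. The total neighbourhood $N_t(x)$ is the set of elements adjacent to $x$, and $d_t(x)=|N_t(x)|$. A total $k$-colouring is a surjective map $\mathbf{c}:V\cup E\to\{1,\dots,k\}$ with $\mathbf{c}(x)\neq\mathbf{c}(y)$ whenever $y\in N_t(x)$. An element $x$ is total b-chromatic if $\mathbf{c}(N_t(x))=\{1,\dots,k\}\setminus\{\mathbf{c}(x)\}$. A total b-chromatic $k$-colouring is a total $k$-colouring in which every colour class contains a total b-chromatic element. $\varphi_t(G)$ is the maximum $k$ for which a total b-chromatic $k$-colouring exists. With elements ordered by non-increasing total degree $d_t(x_1)\ge d_t(x_2)\ge\cdots$, the total $m$-degree is $m_t(G)=\max\{i: d_t(x_i)\ge i-1\}$. -}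

module Defs where

open import Data.Bool using (Bool; true; false; _∧_; _∨_; not; if_then_else_)
open import Data.Nat using (ℕ; zero; suc; _+_; _≤_; _<ᵇ_; _≤ᵇ_; _≡ᵇ_)
open import Data.Fin using (Fin; toℕ)
import Data.Fin as Fin
open import Data.List using (List; []; _∷_; map; _++_; filterᵇ; length; reverse; allFin; cartesianProduct)
open import Data.Product using (Σ; _×_; _,_; proj₁; proj₂; ∃)
open import Data.Sum using (_⊎_; inj₁; inj₂)
open import Relation.Binary.PropositionalEquality using (_≡_; _≢_)
open import Relation.Nullary.Decidable using (⌊_⌋)
open import Function.Bundles using (Bijection)

insertDesc : ℕ → List ℕ → List ℕ
insertDesc x [] = x ∷ []
insertDesc x (y ∷ ys) = if y ≤ᵇ x then x ∷ y ∷ ys else y ∷ insertDesc x ys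

sortDesc : List ℕ → List ℕ
sortDesc [] = []
sortDesc (x ∷ xs) = insertDesc x (sortDesc xs)

record Graph : Set where
  field
    n      : ℕ
    adj    : Fin n → Fin n → Bool
    sym    : ∀ i j → adj i j ≡ adj j i
    irrefl : ∀ i → adj i i ≡ false

module _ (G : Graph) where
  open Graph G

  RawElem : Set
  RawElem = Fin n ⊎ (Fin n × Fin n)

  -- A pair (i , j) represents the edge {i,j} iff i < j and i ~ j.
  isElem : RawElem → Bool
  isElem (inj₁ v) = true
  isElem (inj₂ (i , j)) = (toℕ i <ᵇ toℕ j) ∧ adj i j

  -- Elements of G: V ∪ E (each edge represented once, with i < j).
  Elem : Set
  Elem = Σ RawElem (λ r → isElem r ≡ true)

  eqF : Fin n → Fin n → Bool
  eqF i j = ⌊ i Fin.≟ j ⌋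

  adjR : RawElem → RawElem → Bool
  adjR (inj₁ u) (inj₁ v) = adj u v
  adjR (inj₁ u) (inj₂ (i , j)) = eqF u i ∨ eqF u j
  adjR (inj₂ (i , j)) (inj₁ u) = eqF u i ∨ eqF u j
  adjR (inj₂ (i , j)) (inj₂ (k , l)) =
    not (eqF i k ∧ eqF j l) ∧ (eqF i k ∨ eqF i l ∨ eqF j k ∨ eqF j l)

  Adjacent : Elem → Elem → Set
  Adjacent x y = adjR (proj₁ x) (proj₁ y) ≡ true

  allRaw : List RawElem
  allRaw = map inj₁ (allFin n) ++ map inj₂ (cartesianProduct (allFin n) (allFin n))

  elemsRaw : List RawElem
  elemsRaw = filterᵇ isElem allRaw

  dtR : RawElem → ℕ
  dtR r = length (filterᵇ (adjR r) elemsRaw)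

  dt : Elem → ℕ
  dt x = dtR (proj₁ x)

  sortedDegrees : List ℕ
  sortedDegrees = sortDesc (map dtR elemsRaw)

  max' : ℕ → ℕ → ℕ
  max' a b = if a ≤ᵇ b then b else a

  -- mtAux i ds : max { p : d_p ≥ p - 1 } where ds lists d_{i+1}, d_{i+2}, ...
  -- (0 if no such p)
  mtAux : ℕ → List ℕ → ℕ
  mtAux i [] = 0
  mtAux i (d ∷ ds) = if i ≤ᵇ d then max' (suc i) (mtAux (suc i) ds) else mtAux (suc i) ds

  mt : ℕ
  mt = mtAux 0 sortedDegrees

  IsTotalColouring : (k : ℕ) → (Elem → Fin k) → Set
  IsTotalColouring k c =
    (∀ a → ∃ λ x → c x ≡ a) × (∀ x y → Adjacent x y → c x ≢ c y)

  -- x is total b-chromatic: its neighbourhood sees every other colour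
  -- (properness ensures the colour of x itself is not seen).
  IsTotalBChromatic : (k : ℕ) → (Elem → Fin k) → Elem → Set
  IsTotalBChromatic k c x = ∀ a → a ≢ c x → ∃ λ y → Adjacent x y × c y ≡ a

  TotalBColouring : ℕ → Set
  TotalBColouring k = Σ (Elem → Fin k) λ c →
    IsTotalColouring k c × (∀ a → ∃ λ x → c x ≡ a × IsTotalBChromatic k c x)

  IsPhiT : ℕ → Set
  IsPhiT v = TotalBColouring v × (∀ k → TotalBColouring k → k ≤ v)

pathAdj : ∀ {n} → Fin n → Fin n → Bool
pathAdj i j = (suc (toℕ i) ≡ᵇ toℕ j) ∨ (suc (toℕ j) ≡ᵇ toℕ i)

IsPath : Graph → Set
IsPath G = Σ (Bijection (≡.setoid (Fin n)) (≡.setoid (Fin n))) λ f →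
    ∀ i j → adj (Bijection.to f i) (Bijection.to f j) ≡ pathAdj i j
  where open Graph G
        import Relation.Binary.PropositionalEquality as ≡

{-# OPTIONS --safe #-}
-- Number the elements of P_n along the path: vertex i gets position 2i and the edge {i, i+1}
-- position 2i+1.  Adjacent elements have positions differing by 1 or 2, so every total degree is
-- at most 4, whence m_t(P_n) ≤ 5, and colouring by position modulo k ≥ 3 is proper.
-- In any graph, the b-chromatic elements of a total b-chromatic k-colouring, one per colour, are
-- k distinct elements of total degree at least k - 1, so φ_t ≤ m_t.  Conversely, colouring P_n by
-- position modulo m_t(P_n) is total b-chromatic: for n ≤ 5 by exhaustive search, and for n > 5
-- because the b-chromatic elements found in P_5 stay b-chromatic in every longer path (which also
-- gives m_t(P_n) = 5).  Both φ_t and m_t are invariant under isomorphism.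
module Submission where

open import Defs

open import Data.Bool using (Bool; true; false; if_then_else_; _∧_; _∨_; not)
import Data.Bool.Properties as Boolₚ
open import Data.Bool.Properties using (T-≡; ∨-comm; ∨-identityʳ)
open import Data.Bool.Solver using (module ∨-∧-Solver)
open ∨-∧-Solver using (solve; _:+_; _:*_; _:=_)
open import Data.Empty using (⊥-elim)
open import Data.Fin using (Fin; toℕ; _↑ˡ_)
import Data.Fin as Fin
import Data.Fin.Properties as Finₚ
open import Data.Fin.Properties using (injective⇒≤; toℕ-injective; toℕ-fromℕ<; toℕ-↑ˡ; ↑ˡ-injective)
open import Data.List using (List; []; _∷_; length; filterᵇ; map; lookup; allFin; cartesianProduct)
open import Data.List.Membership.Propositional using (_∈_; lose)
open import Data.List.Membership.Propositional.Properties
  using (∈-lookup; ∈-map⁺; ∈-map⁻; ∈-++⁺ˡ; ∈-++⁺ʳ; ∈-filter⁺; ∈-filter⁻; ∈-allFin;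
         ∈-cartesianProduct⁺)
open import Data.List.Membership.Propositional.Properties.WithK using (unique∧set⇒bag)
open import Data.List.Properties using (map-∘; map-cong-local; map-id)
open import Data.List.Relation.Binary.BagAndSetEquality using (∼bag⇒↭)
open import Data.List.Relation.Binary.Disjoint.Propositional using (Disjoint)
open import Data.List.Relation.Binary.Equality.Propositional using (≋⇒≡)
open import Data.List.Relation.Binary.Permutation.Propositional
  using (_↭_; ↭-reflexive; ↭-trans; ↭-sym; ↭⇒↭ₛ)
open import Data.List.Relation.Binary.Permutation.Propositional.Properties
  using (filter-↭; ↭-length; map⁺; All-resp-↭)
open import Data.List.Relation.Unary.All using (All; []; _∷_)
import Data.List.Relation.Unary.All as All
open import Data.List.Relation.Unary.AllPairs using ([]; _∷_)
open import Data.List.Relation.Unary.Any using (Any; here; there; index; satisfied; any?)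
open import Data.List.Relation.Unary.Any.Properties using (lookup-index)
import Data.List.Relation.Unary.Linked as Linked
open import Data.List.Relation.Unary.Linked.Properties using (Linked⇒All)
open import Data.List.Relation.Unary.Unique.Propositional using (Unique)
import Data.List.Relation.Unary.Unique.Propositional.Properties as Uniqueₚ
open import Data.Nat using (ℕ; zero; suc; NonZero; _+_; _*_; _⊔_; _≤_; _<_; _≤ᵇ_; _<ᵇ_; _≡ᵇ_; z≤n; s≤s)
open import Data.Nat.Divisibility using (_∣_; ∣m+n∣m⇒∣n; n∣m*n; ∣⇒≤)
open import Data.Nat.DivMod using (_%_; _/_; _mod_; m≡m%n+[m/n]*n)
open import Data.Nat.Properties
  using (≤-refl; ≤-reflexive; ≤-trans; ≤-antisym; ≤-pred; n≤1+n; <⇒≤; ≰⇒>; <⇒≱; ≤-<-trans;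
         <-asym; <-irrefl;
         ≤ᵇ-reflects-≤; <ᵇ-reflects-<; ≤⇒≤ᵇ; ≡ᵇ⇒≡; suc-injective; ≤-decTotalOrder;
         +-identityʳ; +-suc; +-comm; +-assoc; +-cancelˡ-≡; *-suc; *-cancelˡ-≡; even≢odd;
         m≤n⇒m⊔n≡n; m≥n⇒m⊔n≡m; m≤m⊔n; m≤n⊔m; ⊔-lub)
open import Data.Product using (Σ; ∃; _×_; _,_; proj₁; proj₂)
open import Data.Sum using (_⊎_; inj₁; inj₂)
import Data.Sum as Sum
open import Data.Sum.Properties using (inj₁-injective; inj₂-injective)
open import Function using (_∘_)
open import Function.Bundles using (Bijection; Equivalence; Inverse; mk⇔)
open import Function.Properties.Bijection using (Bijection⇒Inverse)
open import Relation.Binary.Bundles using (TotalOrder)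
open import Relation.Binary.Definitions using (tri<; tri≈; tri>)
open import Relation.Binary.Properties.DecTotalOrder ≤-decTotalOrder using (≥-decTotalOrder; ≥-totalOrder)
open import Data.List.Sort.InsertionSort.Base ≥-decTotalOrder using (insert; sort)
open import Data.List.Sort.InsertionSort.Properties ≥-decTotalOrder using (sort-↭; sort-↗)
open import Data.List.Relation.Unary.Sorted.TotalOrder ≥-totalOrder using (Sorted)
open import Data.List.Relation.Unary.Sorted.TotalOrder.Properties using (↗↭↗⇒≋)
open import Relation.Binary.PropositionalEquality
  using (_≡_; _≢_; refl; sym; trans; cong; cong₂; subst; subst₂; module ≡-Reasoning)
open import Relation.Binary.PropositionalEquality.WithK using (≡-irrelevant)
open import Relation.Nullary.Decidable
  using (Dec; yes; no; ⌊_⌋; T?; map′; ¬?; _→-dec_; _×-dec_; from-yes)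
open import Relation.Nullary.Negation using (¬_)
open import Relation.Nullary.Reflects using (ofʸ; ofⁿ)

Fin-injection⇒≤length : ∀ {A : Set} {k} (xs : List A) (F : Fin k → A) →
  (∀ {a b} → F a ≡ F b → a ≡ b) → (∀ a → F a ∈ xs) → k ≤ length xs
Fin-injection⇒≤length xs F F-injective F∈xs = injective⇒≤ {f = λ a → index (F∈xs a)} λ {a} {b} eq →
  F-injective (trans (lookup-index (F∈xs a)) (trans (cong (lookup xs) eq) (sym (lookup-index (F∈xs b)))))

Unique-lookup-injective : ∀ {A : Set} {xs : List A} → Unique xs → ∀ {a b} → lookup xs a ≡ lookup xs b → a ≡ b
Unique-lookup-injective {xs = _ ∷ _}  (_ ∷ _)         {Fin.zero}  {Fin.zero}  _  = refl
Unique-lookup-injective {xs = _ ∷ xs} (x∉xs ∷ _)      {Fin.zero}  {Fin.suc b} eq =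
  ⊥-elim (All.lookup x∉xs (∈-lookup {xs = xs} b) eq)
Unique-lookup-injective {xs = _ ∷ xs} (x∉xs ∷ _)      {Fin.suc a} {Fin.zero}  eq =
  ⊥-elim (All.lookup x∉xs (∈-lookup {xs = xs} a) (sym eq))
Unique-lookup-injective {xs = _ ∷ _}  (_ ∷ xs-unique) {Fin.suc a} {Fin.suc b} eq =
  cong Fin.suc (Unique-lookup-injective xs-unique eq)

length-filterᵇ-map : ∀ {A B : Set} (p : B → Bool) (f : A → B) xs →
  length (filterᵇ p (map f xs)) ≡ length (filterᵇ (p ∘ f) xs)
length-filterᵇ-map p f [] = refl
length-filterᵇ-map p f (x ∷ xs) with p (f x)
... | true  = cong suc (length-filterᵇ-map p f xs)
... | false = length-filterᵇ-map p f xs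

filterᵇ-cong-local : ∀ {A : Set} {p q : A → Bool} {xs} →
  All (λ x → p x ≡ q x) xs → filterᵇ p xs ≡ filterᵇ q xs
filterᵇ-cong-local [] = refl
filterᵇ-cong-local {p = p} {q} {x ∷ xs} (px≡qx ∷ rest) with p x | q x | px≡qx
... | true  | true  | refl = cong (x ∷_) (filterᵇ-cong-local rest)
... | false | false | refl = filterᵇ-cong-local rest

-- Sorted degree sequences and the total m-degree

insertDesc≡insert : ∀ x ys → insertDesc x ys ≡ insert x ys
insertDesc≡insert x [] = refl
insertDesc≡insert x (y ∷ ys) with y ≤ᵇ x
... | true  = refl
... | false = cong (y ∷_) (insertDesc≡insert x ys)

sortDesc≡sort : ∀ xs → sortDesc xs ≡ sort xs
sortDesc≡sort [] = refl
sortDesc≡sort (x ∷ xs) rewrite sortDesc≡sort xs = insertDesc≡insert x (sort xs)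

sortDesc-↭ : ∀ xs → sortDesc xs ↭ xs
sortDesc-↭ xs rewrite sortDesc≡sort xs = sort-↭ xs

sortDesc-↗ : ∀ xs → Sorted (sortDesc xs)
sortDesc-↗ xs rewrite sortDesc≡sort xs = sort-↗ xs

sortDesc-cong : ∀ {xs ys} → xs ↭ ys → sortDesc xs ≡ sortDesc ys
sortDesc-cong {xs} {ys} xs↭ys = ≋⇒≡ (↗↭↗⇒≋ ≥-totalOrder (sortDesc-↗ xs) (sortDesc-↗ ys)
  (↭⇒↭ₛ (↭-trans (sortDesc-↭ xs) (↭-trans xs↭ys (↭-sym (sortDesc-↭ ys))))))

atLeast : ℕ → List ℕ → ℕ
atLeast t ds = length (filterᵇ (t ≤ᵇ_) ds)

atLeast-↭ : ∀ t {xs ys} → xs ↭ ys → atLeast t xs ≡ atLeast t ys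
atLeast-↭ t xs↭ys = ↭-length (filter-↭ (T? ∘ (t ≤ᵇ_)) xs↭ys)

atLeast-∷ : ∀ t d ds → atLeast t (d ∷ ds) ≤ suc (atLeast t ds)
atLeast-∷ t d ds with t ≤ᵇ d
... | true  = ≤-refl
... | false = n≤1+n _

atLeast-none : ∀ t {ds} → All (_< t) ds → atLeast t ds ≡ 0
atLeast-none t [] = refl
atLeast-none t {d ∷ ds} (d<t ∷ ds<t) with t ≤ᵇ d | ≤ᵇ-reflects-≤ t d
... | true  | ofʸ t≤d = ⊥-elim (<⇒≱ d<t t≤d)
... | false | _       = atLeast-none t ds<t

Sorted⇒≤head : ∀ {t d ds} → Sorted (d ∷ ds) → 1 ≤ atLeast t (d ∷ ds) → t ≤ d
Sorted⇒≤head {t} {d} {ds} sorted 1≤count with t ≤ᵇ d | ≤ᵇ-reflects-≤ t d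
... | true  | ofʸ t≤d = t≤d
... | false | ofⁿ t≰d = ⊥-elim (<⇒≱ 1≤count (≤-reflexive (atLeast-none t ds<t)))
  where
  ds<t : All (_< t) ds
  ds<t = All.map (λ e≤d → ≤-<-trans e≤d (≰⇒> t≰d))
    (All.tail (Linked⇒All (TotalOrder.trans ≥-totalOrder) ≤-refl sorted))

max'≡⊔ : ∀ G a b → max' G a b ≡ a ⊔ b
max'≡⊔ G a b with a ≤ᵇ b | ≤ᵇ-reflects-≤ a b
... | true  | ofʸ a≤b = sym (m≤n⇒m⊔n≡n a≤b)
... | false | ofⁿ a≰b = sym (m≥n⇒m⊔n≡m (<⇒≤ (≰⇒> a≰b)))

mtAux-∷ : ∀ G i d ds →
  mtAux G i (d ∷ ds) ≡ (if i ≤ᵇ d then suc i ⊔ mtAux G (suc i) ds else mtAux G (suc i) ds)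
mtAux-∷ G i d ds with i ≤ᵇ d
... | true  = max'≡⊔ G (suc i) (mtAux G (suc i) ds)
... | false = refl

mtAux-irrelevant : ∀ G H i ds → mtAux G i ds ≡ mtAux H i ds
mtAux-irrelevant G H i [] = refl
mtAux-irrelevant G H i (d ∷ ds) rewrite mtAux-∷ G i d ds | mtAux-∷ H i d ds | mtAux-irrelevant G H (suc i) ds = refl

mtAux-suc≤ : ∀ G i d ds → mtAux G (suc i) ds ≤ mtAux G i (d ∷ ds)
mtAux-suc≤ G i d ds rewrite mtAux-∷ G i d ds with i ≤ᵇ d
... | true  = m≤n⊔m (suc i) (mtAux G (suc i) ds)
... | false = ≤-refl

head-≤-mtAux : ∀ G {i d} ds → i ≤ d → suc i ≤ mtAux G i (d ∷ ds)
head-≤-mtAux G {i} {d} ds i≤d rewrite mtAux-∷ G i d ds with i ≤ᵇ d | ≤ᵇ-reflects-≤ i d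
... | true  | _       = m≤m⊔n (suc i) (mtAux G (suc i) ds)
... | false | ofⁿ i≰d = ⊥-elim (i≰d i≤d)

mtAux-≤ : ∀ G {d} i {ds} → All (_≤ d) ds → mtAux G i ds ≤ suc d
mtAux-≤ G i [] = z≤n
mtAux-≤ G i {e ∷ ds} (e≤d ∷ ds≤d) rewrite mtAux-∷ G i e ds with i ≤ᵇ e | ≤ᵇ-reflects-≤ i e
... | true  | ofʸ i≤e = ⊔-lub (s≤s (≤-trans i≤e e≤d)) (mtAux-≤ G (suc i) ds≤d)
... | false | _       = mtAux-≤ G (suc i) ds≤d

≤-mtAux : ∀ G i j {ds} → Sorted ds → suc j ≤ atLeast (i + j) ds → suc (i + j) ≤ mtAux G i ds
≤-mtAux G i j       {[]}     _      ()
≤-mtAux G i zero    {d ∷ ds} sorted 1≤count rewrite +-identityʳ i =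
  head-≤-mtAux G ds (Sorted⇒≤head sorted 1≤count)
≤-mtAux G i (suc j) {d ∷ ds} sorted count rewrite +-suc i j = ≤-trans
  (≤-mtAux G (suc i) j (Linked.tail sorted) (≤-pred (≤-trans count (atLeast-∷ _ d ds))))
  (mtAux-suc≤ G i d ds)

-- Elements of a graph

Elem-≡ : ∀ {G} {x y : Elem G} → proj₁ x ≡ proj₁ y → x ≡ y
Elem-≡ {x = r , p} {.r , q} refl = cong (r ,_) (≡-irrelevant p q)

module _ (G : Graph) where
  open Graph G using (n; adj)

  ∈-allRaw : ∀ r → r ∈ allRaw G
  ∈-allRaw (inj₁ v)       = ∈-++⁺ˡ (∈-map⁺ inj₁ (∈-allFin v))
  ∈-allRaw (inj₂ (i , j)) = ∈-++⁺ʳ _ (∈-map⁺ inj₂ (∈-cartesianProduct⁺ (∈-allFin i) (∈-allFin j)))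

  ∈-elemsRaw⁺ : ∀ {r} → isElem G r ≡ true → r ∈ elemsRaw G
  ∈-elemsRaw⁺ {r} valid = ∈-filter⁺ (T? ∘ isElem G) (∈-allRaw r) (Equivalence.from T-≡ valid)

  ∈-elemsRaw⁻ : ∀ {r} → r ∈ elemsRaw G → isElem G r ≡ true
  ∈-elemsRaw⁻ r∈ = Equivalence.to T-≡ (proj₂ (∈-filter⁻ (T? ∘ isElem G) {xs = allRaw G} r∈))

  elemsRaw-unique : Unique (elemsRaw G)
  elemsRaw-unique = Uniqueₚ.filter⁺ (T? ∘ isElem G) (Uniqueₚ.++⁺
    (Uniqueₚ.map⁺ inj₁-injective (Uniqueₚ.allFin⁺ n))
    (Uniqueₚ.map⁺ inj₂-injective (Uniqueₚ.cartesianProduct⁺ (Uniqueₚ.allFin⁺ n) (Uniqueₚ.allFin⁺ n)))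
    vertices-disjoint-edges)
    where
    vertices-disjoint-edges : Disjoint (map inj₁ (allFin n)) (map inj₂ (cartesianProduct (allFin n) (allFin n)))
    vertices-disjoint-edges (r∈vertices , r∈edges) with ∈-map⁻ inj₁ r∈vertices | ∈-map⁻ inj₂ r∈edges
    ... | _ , _ , refl | _ , _ , ()

  isEdge⁻ : ∀ {i j} → isElem G (inj₂ (i , j)) ≡ true → toℕ i < toℕ j × adj i j ≡ true
  isEdge⁻ {i} {j} valid with toℕ i <ᵇ toℕ j | <ᵇ-reflects-< (toℕ i) (toℕ j)
  ... | true | ofʸ i<j = i<j , valid

  isEdge⁺ : ∀ {i j} → toℕ i < toℕ j → adj i j ≡ true → isElem G (inj₂ (i , j)) ≡ true
  isEdge⁺ {i} {j} i<j i~j with toℕ i <ᵇ toℕ j | <ᵇ-reflects-< (toℕ i) (toℕ j)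
  ... | true  | _       = i~j
  ... | false | ofⁿ i≮j = ⊥-elim (i≮j i<j)

  any-Elem? : {Q : Elem G → Set} → (∀ x → Dec (Q x)) → Dec (∃ Q)
  any-Elem? {Q} Q? = map′ fromAny toAny (any? validQ? (elemsRaw G))
    where
    ValidQ : RawElem G → Set
    ValidQ r = Σ (isElem G r ≡ true) λ valid → Q (r , valid)
    validQ? : ∀ r → Dec (ValidQ r)
    validQ? r with isElem G r Boolₚ.≟ true
    ... | yes valid = map′ (valid ,_)
      (λ (valid′ , q) → subst (λ v → Q (r , v)) (≡-irrelevant valid′ valid) q) (Q? (r , valid))
    ... | no ¬valid = no (¬valid ∘ proj₁)
    fromAny : Any ValidQ (elemsRaw G) → ∃ Q
    fromAny any with satisfied any
    ... | r , valid , q = (r , valid) , q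
    toAny : ∃ Q → Any ValidQ (elemsRaw G)
    toAny ((r , valid) , q) = lose (∈-elemsRaw⁺ valid) (valid , q)

-- Total b-colourings and the bound φ_t ≤ m_t

BChromaticInEveryClass : (G : Graph) (k : ℕ) → (Elem G → Fin k) → Set
BChromaticInEveryClass G k c = ∀ a → ∃ λ x → c x ≡ a × IsTotalBChromatic G k c x

bColouring : ∀ {G k} (c : Elem G → Fin k) → (∀ x y → Adjacent G x y → c x ≢ c y) →
  BChromaticInEveryClass G k c → TotalBColouring G k
bColouring c proper classes = c , ((λ a → proj₁ (classes a) , proj₁ (proj₂ (classes a))) , proper) , classes

module _ (G : Graph) {k} (c : Elem G → Fin k) where

  isTotalBChromatic? : ∀ x → Dec (IsTotalBChromatic G k c x)
  isTotalBChromatic? x = Finₚ.all? λ a → ¬? (a Fin.≟ c x) →-dec any-Elem? G λ y →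
    (adjR G (proj₁ x) (proj₁ y) Boolₚ.≟ true) ×-dec (c y Fin.≟ a)

  bChromaticInEveryClass? : Dec (BChromaticInEveryClass G k c)
  bChromaticInEveryClass? = Finₚ.all? λ a → any-Elem? G λ x → (c x Fin.≟ a) ×-dec isTotalBChromatic? x

  colour-≡ : ∀ {x y a b} → c x ≡ a → c y ≡ b → proj₁ x ≡ proj₁ y → a ≡ b
  colour-≡ cx≡a cy≡b x≡y = trans (sym cx≡a) (trans (cong c (Elem-≡ x≡y)) cy≡b)

  closedNeighbourOfColour : ∀ {x} → IsTotalBChromatic G k c x →
    ∀ a → ∃ λ y → c y ≡ a × (y ≡ x ⊎ Adjacent G x y)
  closedNeighbourOfColour {x} x-b a with a Fin.≟ c x
  ... | yes refl = x , refl , inj₁ refl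
  ... | no a≢cx with x-b a a≢cx
  ...   | y , x~y , cy≡a = y , cy≡a , inj₂ x~y

  bChromatic⇒≤1+dt : ∀ {x} → IsTotalBChromatic G k c x → k ≤ suc (dt G x)
  bChromatic⇒≤1+dt {x} x-b = Fin-injection⇒≤length _ F F-injective F∈
    where
    F : Fin k → RawElem G
    F a = proj₁ (proj₁ (closedNeighbourOfColour x-b a))
    F-injective : ∀ {a b} → F a ≡ F b → a ≡ b
    F-injective {a} {b} =
      colour-≡ (proj₁ (proj₂ (closedNeighbourOfColour x-b a))) (proj₁ (proj₂ (closedNeighbourOfColour x-b b)))
    F∈ : ∀ a → F a ∈ proj₁ x ∷ filterᵇ (adjR G (proj₁ x)) (elemsRaw G)
    F∈ a with closedNeighbourOfColour x-b a
    ... | _ , _ , inj₁ refl = here refl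
    ... | y , _ , inj₂ x~y  =
      there (∈-filter⁺ (T? ∘ adjR G (proj₁ x)) (∈-elemsRaw⁺ G (proj₂ y)) (Equivalence.from T-≡ x~y))

bColouring⇒≤mt : ∀ G k → TotalBColouring G k → k ≤ mt G
bColouring⇒≤mt G zero    _                = z≤n
bColouring⇒≤mt G (suc k) (c , _ , classes) =
  ≤-mtAux G 0 k (sortDesc-↗ degrees) (subst (suc k ≤_) count≡ (Fin-injection⇒≤length _ F F-injective F∈))
  where
  degrees : List ℕ
  degrees = map (dtR G) (elemsRaw G)
  F : Fin (suc k) → RawElem G
  F a = proj₁ (proj₁ (classes a))
  F-injective : ∀ {a b} → F a ≡ F b → a ≡ b
  F-injective {a} {b} = colour-≡ G c (proj₁ (proj₂ (classes a))) (proj₁ (proj₂ (classes b)))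
  F∈ : ∀ a → F a ∈ filterᵇ ((k ≤ᵇ_) ∘ dtR G) (elemsRaw G)
  F∈ a = ∈-filter⁺ (T? ∘ (k ≤ᵇ_) ∘ dtR G) (∈-elemsRaw⁺ G (proj₂ (proj₁ (classes a))))
    (≤⇒≤ᵇ (≤-pred (bChromatic⇒≤1+dt G c (proj₂ (proj₂ (classes a))))))
  count≡ : length (filterᵇ ((k ≤ᵇ_) ∘ dtR G) (elemsRaw G)) ≡ atLeast k (sortDesc degrees)
  count≡ = trans (sym (length-filterᵇ-map (k ≤ᵇ_) (dtR G) (elemsRaw G)))
                 (atLeast-↭ k (↭-sym (sortDesc-↭ degrees)))

module _ {G H : Graph} (F : Elem G → Elem H) (F-adjacent : ∀ x y → Adjacent G x y → Adjacent H (F x) (F y))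
         {k} {c : Elem G → Fin k} {c′ : Elem H → Fin k} (c′∘F≗c : ∀ x → c′ (F x) ≡ c x) where

  bChromatic-transport : ∀ {x} → IsTotalBChromatic G k c x → IsTotalBChromatic H k c′ (F x)
  bChromatic-transport {x} x-b a a≢c′Fx with x-b a (λ a≡cx → a≢c′Fx (trans a≡cx (sym (c′∘F≗c x))))
  ... | y , x~y , cy≡a = F y , F-adjacent x y x~y , trans (c′∘F≗c y) cy≡a

  bChromaticInEveryClass-transport : BChromaticInEveryClass G k c → BChromaticInEveryClass H k c′
  bChromaticInEveryClass-transport classes a with classes a
  ... | x , cx≡a , x-b = F x , trans (c′∘F≗c x) cx≡a , bChromatic-transport x-b

-- Embeddings and isomorphisms of graphs

ordered : ∀ {m} → Fin m → Fin m → Fin m × Fin m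
ordered a b = if toℕ a <ᵇ toℕ b then (a , b) else (b , a)

ordered-cases : ∀ {m} (a b : Fin m) → ordered a b ≡ (a , b) ⊎ ordered a b ≡ (b , a)
ordered-cases a b with toℕ a <ᵇ toℕ b
... | true  = inj₁ refl
... | false = inj₂ refl

ordered-< : ∀ {m} {a b : Fin m} → toℕ a < toℕ b → ordered a b ≡ (a , b)
ordered-< {a = a} {b} a<b with toℕ a <ᵇ toℕ b | <ᵇ-reflects-< (toℕ a) (toℕ b)
... | true  | _       = refl
... | false | ofⁿ a≮b = ⊥-elim (a≮b a<b)

ordered-> : ∀ {m} {a b : Fin m} → toℕ b < toℕ a → ordered a b ≡ (b , a)
ordered-> {a = a} {b} b<a with toℕ a <ᵇ toℕ b | <ᵇ-reflects-< (toℕ a) (toℕ b)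
... | true  | ofʸ a<b = ⊥-elim (<-asym a<b b<a)
... | false | _       = refl

ordered-increasing : ∀ {m} {a b : Fin m} → a ≢ b → toℕ (proj₁ (ordered a b)) < toℕ (proj₂ (ordered a b))
ordered-increasing {a = a} {b} a≢b with Finₚ.<-cmp a b
... | tri< a<b _   _   rewrite ordered-< a<b = a<b
... | tri≈ _   a≡b _   = ⊥-elim (a≢b a≡b)
... | tri> _   _   b<a rewrite ordered-> b<a = b<a

adj-ordered : ∀ G a b → Graph.adj G (proj₁ (ordered a b)) (proj₂ (ordered a b)) ≡ Graph.adj G a b
adj-ordered G a b with ordered-cases a b
... | inj₁ eq rewrite eq = refl
... | inj₂ eq rewrite eq = Graph.sym G b a

module _ {m : ℕ} where

  infix 4 _≟ᵇ_
  _≟ᵇ_ : Fin m → Fin m → Bool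
  a ≟ᵇ b = ⌊ a Fin.≟ b ⌋

  incident : Fin m → Fin m × Fin m → Bool
  incident u (a , b) = (u ≟ᵇ a) ∨ (u ≟ᵇ b)

  sameEdge meetEdge edgesAdjacent : Fin m × Fin m → Fin m × Fin m → Bool
  sameEdge (a , b) (c , d) = ((a ≟ᵇ c) ∧ (b ≟ᵇ d)) ∨ ((a ≟ᵇ d) ∧ (b ≟ᵇ c))
  meetEdge (a , b) (c , d) = (a ≟ᵇ c) ∨ (a ≟ᵇ d) ∨ (b ≟ᵇ c) ∨ (b ≟ᵇ d)
  edgesAdjacent e f = not (sameEdge e f) ∧ meetEdge e f

  edgesAdjacent-swapˡ : ∀ a b f → edgesAdjacent (b , a) f ≡ edgesAdjacent (a , b) f
  edgesAdjacent-swapˡ a b (c , d) = cong₂ (λ same meet → not same ∧ meet)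
    (solve 4 (λ ac bd ad bc → bc :* ad :+ bd :* ac := ac :* bd :+ ad :* bc) refl
       (a ≟ᵇ c) (b ≟ᵇ d) (a ≟ᵇ d) (b ≟ᵇ c))
    (solve 4 (λ ac ad bc bd → bc :+ (bd :+ (ac :+ ad)) := ac :+ (ad :+ (bc :+ bd))) refl
       (a ≟ᵇ c) (a ≟ᵇ d) (b ≟ᵇ c) (b ≟ᵇ d))

  edgesAdjacent-swapʳ : ∀ e c d → edgesAdjacent e (d , c) ≡ edgesAdjacent e (c , d)
  edgesAdjacent-swapʳ (a , b) c d = cong₂ (λ same meet → not same ∧ meet)
    (∨-comm ((a ≟ᵇ d) ∧ (b ≟ᵇ c)) ((a ≟ᵇ c) ∧ (b ≟ᵇ d)))
    (solve 4 (λ ac ad bc bd → ad :+ (ac :+ (bd :+ bc)) := ac :+ (ad :+ (bc :+ bd))) refl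
       (a ≟ᵇ c) (a ≟ᵇ d) (b ≟ᵇ c) (b ≟ᵇ d))

  incident-ordered : ∀ u a b → incident u (ordered a b) ≡ incident u (a , b)
  incident-ordered u a b with ordered-cases a b
  ... | inj₁ eq rewrite eq = refl
  ... | inj₂ eq rewrite eq = ∨-comm (u ≟ᵇ b) (u ≟ᵇ a)

  edgesAdjacent-ordered : ∀ a b c d → edgesAdjacent (ordered a b) (ordered c d) ≡ edgesAdjacent (a , b) (c , d)
  edgesAdjacent-ordered a b c d with ordered-cases a b | ordered-cases c d
  ... | inj₁ eq | inj₁ eq′ rewrite eq | eq′ = refl
  ... | inj₁ eq | inj₂ eq′ rewrite eq | eq′ = edgesAdjacent-swapʳ (a , b) c d
  ... | inj₂ eq | inj₁ eq′ rewrite eq | eq′ = edgesAdjacent-swapˡ a b (c , d)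
  ... | inj₂ eq | inj₂ eq′ rewrite eq | eq′ =
    trans (edgesAdjacent-swapˡ a b (d , c)) (edgesAdjacent-swapʳ (a , b) c d)

≟ᵇ-injective : ∀ {m m′} {g : Fin m → Fin m′} → (∀ {a b} → g a ≡ g b → a ≡ b) →
  ∀ a b → (g a ≟ᵇ g b) ≡ (a ≟ᵇ b)
≟ᵇ-injective {g = g} g-injective a b with a Fin.≟ b | g a Fin.≟ g b
... | yes refl | yes _     = refl
... | yes refl | no ga≢ga  = ⊥-elim (ga≢ga refl)
... | no a≢b   | yes ga≡gb = ⊥-elim (a≢b (g-injective ga≡gb))
... | no _     | no _      = refl

increasing-pairs-not-reversed : ∀ {m} {i j k l : Fin m} → toℕ i < toℕ j → toℕ k < toℕ l →
  ((i ≟ᵇ l) ∧ (j ≟ᵇ k)) ≡ false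
increasing-pairs-not-reversed {i = i} {j} {k} {l} i<j k<l with i Fin.≟ l | j Fin.≟ k
... | no _     | _        = refl
... | yes _    | no _     = refl
... | yes refl | yes refl = ⊥-elim (<-asym i<j k<l)

-- adjR recognises equal edges only in the orientation (i , j) = (k , l); on increasing pairs this
-- agrees with the orientation-free edgesAdjacent, which is what a vertex map preserves.
adjR-edges : ∀ G {i j k l} → toℕ i < toℕ j → toℕ k < toℕ l →
  adjR G (inj₂ (i , j)) (inj₂ (k , l)) ≡ edgesAdjacent (i , j) (k , l)
adjR-edges G {i} {j} {k} {l} i<j k<l = cong (λ same → not same ∧ meetEdge (i , j) (k , l))
  (sym (trans (cong (((i ≟ᵇ k) ∧ (j ≟ᵇ l)) ∨_) (increasing-pairs-not-reversed i<j k<l)) (∨-identityʳ _)))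

record _↪_ (G H : Graph) : Set where
  field
    vertex           : Fin (Graph.n G) → Fin (Graph.n H)
    vertex-injective : ∀ {i j} → vertex i ≡ vertex j → i ≡ j
    adj-vertex       : ∀ i j → Graph.adj H (vertex i) (vertex j) ≡ Graph.adj G i j

module Embedding {G H : Graph} (e : G ↪ H) where
  open _↪_ e

  raw : RawElem G → RawElem H
  raw (inj₁ v)       = inj₁ (vertex v)
  raw (inj₂ (i , j)) = inj₂ (ordered (vertex i) (vertex j))

  private
    vertex-≟ᵇ : ∀ a b → (vertex a ≟ᵇ vertex b) ≡ (a ≟ᵇ b)
    vertex-≟ᵇ = ≟ᵇ-injective vertex-injective

    vertex-≢ : ∀ {i j} → toℕ i < toℕ j → vertex i ≢ vertex j
    vertex-≢ i<j vi≡vj = <-irrefl (cong toℕ (vertex-injective vi≡vj)) i<j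

    incident-vertex : ∀ u i j → incident (vertex u) (ordered (vertex i) (vertex j)) ≡ incident u (i , j)
    incident-vertex u i j = trans (incident-ordered (vertex u) (vertex i) (vertex j))
      (cong₂ _∨_ (vertex-≟ᵇ u i) (vertex-≟ᵇ u j))

    edgesAdjacent-vertex : ∀ {i j k l} →
      edgesAdjacent (vertex i , vertex j) (vertex k , vertex l) ≡ edgesAdjacent (i , j) (k , l)
    edgesAdjacent-vertex {i} {j} {k} {l}
      rewrite vertex-≟ᵇ i k | vertex-≟ᵇ i l | vertex-≟ᵇ j k | vertex-≟ᵇ j l = refl

  raw-isElem : ∀ r → isElem G r ≡ true → isElem H (raw r) ≡ true
  raw-isElem (inj₁ v)       _     = refl
  raw-isElem (inj₂ (i , j)) valid with isEdge⁻ G valid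
  ... | i<j , i~j = isEdge⁺ H (ordered-increasing (vertex-≢ i<j))
    (trans (adj-ordered H (vertex i) (vertex j)) (trans (adj-vertex i j) i~j))

  raw-adjR : ∀ r s → isElem G r ≡ true → isElem G s ≡ true → adjR H (raw r) (raw s) ≡ adjR G r s
  raw-adjR (inj₁ u)       (inj₁ v)       _ _ = adj-vertex u v
  raw-adjR (inj₁ u)       (inj₂ (i , j)) _ _ = incident-vertex u i j
  raw-adjR (inj₂ (i , j)) (inj₁ u)       _ _ = incident-vertex u i j
  raw-adjR (inj₂ (i , j)) (inj₂ (k , l)) r-valid s-valid = begin
    adjR H (inj₂ (ordered (vertex i) (vertex j))) (inj₂ (ordered (vertex k) (vertex l)))
      ≡⟨ adjR-edges H (ordered-increasing (vertex-≢ i<j)) (ordered-increasing (vertex-≢ k<l)) ⟩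
    edgesAdjacent (ordered (vertex i) (vertex j)) (ordered (vertex k) (vertex l))
      ≡⟨ edgesAdjacent-ordered (vertex i) (vertex j) (vertex k) (vertex l) ⟩
    edgesAdjacent (vertex i , vertex j) (vertex k , vertex l)
      ≡⟨ edgesAdjacent-vertex ⟩
    edgesAdjacent (i , j) (k , l)
      ≡⟨ adjR-edges G i<j k<l ⟨
    adjR G (inj₂ (i , j)) (inj₂ (k , l))  ∎
    where
    open ≡-Reasoning
    i<j = proj₁ (isEdge⁻ G r-valid)
    k<l = proj₁ (isEdge⁻ G s-valid)

  elem : Elem G → Elem H
  elem (r , valid) = raw r , raw-isElem r valid

  elem-adjacent : ∀ x y → Adjacent G x y → Adjacent H (elem x) (elem y)
  elem-adjacent (r , r-valid) (s , s-valid) r~s = trans (raw-adjR r s r-valid s-valid) r~s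

raw-retraction : ∀ {G H} (e : G ↪ H) (e′ : H ↪ G) → (∀ i → _↪_.vertex e′ (_↪_.vertex e i) ≡ i) →
  ∀ r → isElem G r ≡ true → Embedding.raw e′ (Embedding.raw e r) ≡ r
raw-retraction {G} e e′ e′∘e≗id (inj₁ v)       _     = cong inj₁ (e′∘e≗id v)
raw-retraction {G} e e′ e′∘e≗id (inj₂ (i , j)) valid with ordered-cases (_↪_.vertex e i) (_↪_.vertex e j)
... | inj₁ eq rewrite eq | e′∘e≗id i | e′∘e≗id j = cong inj₂ (ordered-< (proj₁ (isEdge⁻ G valid)))
... | inj₂ eq rewrite eq | e′∘e≗id i | e′∘e≗id j = cong inj₂ (ordered-> (proj₁ (isEdge⁻ G valid)))

record _≅_ (G H : Graph) : Set where
  field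
    to      : G ↪ H
    from    : H ↪ G
    from-to : ∀ i → _↪_.vertex from (_↪_.vertex to i) ≡ i
    to-from : ∀ j → _↪_.vertex to (_↪_.vertex from j) ≡ j

module Isomorphism {G H : Graph} (iso : G ≅ H) where
  open _≅_ iso
  open Embedding to using ()
    renaming (raw to φ; raw-isElem to φ-isElem; raw-adjR to φ-adjR; elem to Φ; elem-adjacent to Φ-adjacent)
  open Embedding from using ()
    renaming (raw to ψ; raw-isElem to ψ-isElem; elem to Ψ; elem-adjacent to Ψ-adjacent)

  elemsRaw-↭ : elemsRaw H ↭ map φ (elemsRaw G)
  elemsRaw-↭ = ∼bag⇒↭ (unique∧set⇒bag (elemsRaw-unique H) φ-elemsRaw-unique (mk⇔ to-image from-image))
    where
    ψ∘φ-elemsRaw : map ψ (map φ (elemsRaw G)) ≡ elemsRaw G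
    ψ∘φ-elemsRaw = trans (sym (map-∘ (elemsRaw G)))
      (trans (map-cong-local (All.tabulate λ r∈ → raw-retraction to from from-to _ (∈-elemsRaw⁻ G r∈)))
             (map-id (elemsRaw G)))
    φ-elemsRaw-unique : Unique (map φ (elemsRaw G))
    φ-elemsRaw-unique = Uniqueₚ.map⁻ (subst Unique (sym ψ∘φ-elemsRaw) (elemsRaw-unique G))
    to-image : ∀ {z} → z ∈ elemsRaw H → z ∈ map φ (elemsRaw G)
    to-image {z} z∈ = subst (_∈ map φ (elemsRaw G)) (raw-retraction from to to-from z (∈-elemsRaw⁻ H z∈))
      (∈-map⁺ φ (∈-elemsRaw⁺ G (ψ-isElem z (∈-elemsRaw⁻ H z∈))))
    from-image : ∀ {z} → z ∈ map φ (elemsRaw G) → z ∈ elemsRaw H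
    from-image z∈ with ∈-map⁻ φ z∈
    ... | r , r∈ , refl = ∈-elemsRaw⁺ H (φ-isElem r (∈-elemsRaw⁻ G r∈))

  dtR-φ : ∀ {r} → r ∈ elemsRaw G → dtR H (φ r) ≡ dtR G r
  dtR-φ {r} r∈ = begin
    length (filterᵇ (adjR H (φ r)) (elemsRaw H))
      ≡⟨ ↭-length (filter-↭ (T? ∘ adjR H (φ r)) elemsRaw-↭) ⟩
    length (filterᵇ (adjR H (φ r)) (map φ (elemsRaw G)))
      ≡⟨ length-filterᵇ-map (adjR H (φ r)) φ (elemsRaw G) ⟩
    length (filterᵇ (adjR H (φ r) ∘ φ) (elemsRaw G))
      ≡⟨ cong length (filterᵇ-cong-local (All.tabulate λ s∈ → φ-adjR r _ (∈-elemsRaw⁻ G r∈) (∈-elemsRaw⁻ G s∈))) ⟩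
    length (filterᵇ (adjR G r) (elemsRaw G))  ∎
    where open ≡-Reasoning

  mt-≡ : mt H ≡ mt G
  mt-≡ = trans (cong (mtAux H 0) (sortDesc-cong degrees-↭)) (mtAux-irrelevant H G 0 (sortedDegrees G))
    where
    degrees-↭ : map (dtR H) (elemsRaw H) ↭ map (dtR G) (elemsRaw G)
    degrees-↭ = ↭-trans (map⁺ (dtR H) elemsRaw-↭)
      (↭-reflexive (trans (sym (map-∘ (elemsRaw G))) (map-cong-local (All.tabulate dtR-φ))))

  Φ∘Ψ : ∀ y → Φ (Ψ y) ≡ y
  Φ∘Ψ (r , valid) = Elem-≡ (raw-retraction from to to-from r valid)

  bColouring-pullback : ∀ {k} → TotalBColouring H k → TotalBColouring G k
  bColouring-pullback (c , (_ , proper) , classes) = bColouring (c ∘ Φ)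
    (λ x y x~y → proper (Φ x) (Φ y) (Φ-adjacent x y x~y))
    (bChromaticInEveryClass-transport Ψ Ψ-adjacent (λ y → cong c (Φ∘Ψ y)) classes)

-- Paths

1+n≡ᵇn : ∀ m → (suc m ≡ᵇ m) ≡ false
1+n≡ᵇn zero    = refl
1+n≡ᵇn (suc m) = 1+n≡ᵇn m

P : ℕ → Graph
P n = record
  { n      = n
  ; adj    = pathAdj
  ; sym    = λ i j → ∨-comm (suc (toℕ i) ≡ᵇ toℕ j) (suc (toℕ j) ≡ᵇ toℕ i)
  ; irrefl = λ i → cong₂ _∨_ (1+n≡ᵇn (toℕ i)) (1+n≡ᵇn (toℕ i))
  }

IsPath⇒≅P : ∀ G → IsPath G → G ≅ P (Graph.n G)
IsPath⇒≅P G (f , f-adj) = record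
  { to      = record { vertex = from ; vertex-injective = from-injective ; adj-vertex = from-adj }
  ; from    = record { vertex = to ; vertex-injective = Bijection.injective f ; adj-vertex = f-adj }
  ; from-to = strictlyInverseˡ
  ; to-from = strictlyInverseʳ
  }
  where
  open Inverse (Bijection⇒Inverse f) using (to; from; strictlyInverseˡ; strictlyInverseʳ)
  from-injective : ∀ {u v} → from u ≡ from v → u ≡ v
  from-injective {u} {v} eq = trans (sym (strictlyInverseˡ u)) (trans (cong to eq) (strictlyInverseˡ v))
  from-adj : ∀ u v → pathAdj (from u) (from v) ≡ Graph.adj G u v
  from-adj u v = trans (sym (f-adj (from u) (from v))) (cong₂ (Graph.adj G) (strictlyInverseˡ u) (strictlyInverseˡ v))

prefix : ∀ m k → P m ↪ P (m + k)
prefix m k = record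
  { vertex           = _↑ˡ k
  ; vertex-injective = ↑ˡ-injective k _ _
  ; adj-vertex       = λ i j → cong₂ (λ a b → (suc a ≡ᵇ b) ∨ (suc b ≡ᵇ a)) (toℕ-↑ˡ i k) (toℕ-↑ˡ j k)
  }

data Step : ℕ → ℕ → Set where
  one : ∀ {p} → Step p (suc p)
  two : ∀ {p} → Step p (suc (suc p))

Near : ℕ → ℕ → Set
Near p q = Step p q ⊎ Step q p

double-step : ∀ a → Step (2 * a) (2 * suc a)
double-step a = subst (Step (2 * a)) (sym (*-suc 2 a)) two

odd-double-step : ∀ a → Step (suc (2 * a)) (2 * suc a)
odd-double-step a = subst (Step (suc (2 * a))) (sym (*-suc 2 a)) one

odd-step : ∀ a → Step (suc (2 * a)) (suc (2 * suc a))
odd-step a = subst (Step (suc (2 * a)) ∘ suc) (sym (*-suc 2 a)) two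

Near⇒∈ : ∀ {p q} → Near p q → suc (suc q) ∈ p ∷ suc p ∷ suc (suc (suc p)) ∷ suc (suc (suc (suc p))) ∷ []
Near⇒∈ (inj₁ one) = there (there (here refl))
Near⇒∈ (inj₁ two) = there (there (there (here refl)))
Near⇒∈ (inj₂ one) = there (here refl)
Near⇒∈ (inj₂ two) = here refl

module _ {n : ℕ} where

  pos : RawElem (P n) → ℕ
  pos (inj₁ v)       = 2 * toℕ v
  pos (inj₂ (i , _)) = suc (2 * toℕ i)

  pathAdj⁻ : ∀ (u v : Fin n) → pathAdj u v ≡ true → toℕ v ≡ suc (toℕ u) ⊎ toℕ u ≡ suc (toℕ v)
  pathAdj⁻ u v u~v with suc (toℕ u) ≡ᵇ toℕ v in eq
  ... | true  = inj₁ (sym (≡ᵇ⇒≡ _ _ (Equivalence.from T-≡ eq)))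
  ... | false = inj₂ (sym (≡ᵇ⇒≡ _ _ (Equivalence.from T-≡ u~v)))

  edge-suc : ∀ (i j : Fin n) → isElem (P n) (inj₂ (i , j)) ≡ true → toℕ j ≡ suc (toℕ i)
  edge-suc i j valid with isEdge⁻ (P n) valid
  ... | i<j , i~j with pathAdj⁻ i j i~j
  ...   | inj₁ j≡1+i = j≡1+i
  ...   | inj₂ i≡1+j = ⊥-elim (<-asym i<j (≤-reflexive (sym i≡1+j)))

  adjacent⇒near : ∀ r s → isElem (P n) r ≡ true → isElem (P n) s ≡ true →
    adjR (P n) r s ≡ true → Near (pos r) (pos s)
  adjacent⇒near (inj₁ u) (inj₁ v) _ _ u~v with pathAdj⁻ u v u~v
  ... | inj₁ v≡1+u = subst (λ b → Near (2 * toℕ u) (2 * b)) (sym v≡1+u) (inj₁ (double-step (toℕ u)))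
  ... | inj₂ u≡1+v = subst (λ a → Near (2 * a) (2 * toℕ v)) (sym u≡1+v) (inj₂ (double-step (toℕ v)))
  adjacent⇒near (inj₁ u) (inj₂ (i , j)) _ e-valid u∈e with u Fin.≟ i | u Fin.≟ j
  ... | yes refl | _        = inj₁ one
  ... | no _     | yes refl =
    subst (λ a → Near (2 * a) (suc (2 * toℕ i))) (sym (edge-suc i j e-valid)) (inj₂ (odd-double-step (toℕ i)))
  adjacent⇒near (inj₂ e) (inj₁ u) e-valid u-valid u∈e =
    Sum.swap (adjacent⇒near (inj₁ u) (inj₂ e) u-valid e-valid u∈e)
  adjacent⇒near (inj₂ (i , j)) (inj₂ (k , l)) e-valid f-valid e~f with i Fin.≟ l
  ... | yes refl =
    subst (λ a → Near (suc (2 * a)) (suc (2 * toℕ k))) (sym (edge-suc k i f-valid)) (inj₂ (odd-step (toℕ k)))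
  ... | no _ with j Fin.≟ k
  ...   | yes refl =
    subst (λ b → Near (suc (2 * toℕ i)) (suc (2 * b))) (sym (edge-suc i j e-valid)) (inj₁ (odd-step (toℕ i)))
  ...   | no _ with i Fin.≟ k | j Fin.≟ l
  ...     | yes refl | no j≢l   = ⊥-elim (j≢l (toℕ-injective (trans (edge-suc i j e-valid) (sym (edge-suc i l f-valid)))))
  ...     | no i≢k   | yes refl =
    ⊥-elim (i≢k (toℕ-injective (suc-injective (trans (sym (edge-suc i j e-valid)) (edge-suc k j f-valid)))))

  pos-injective : ∀ r s → isElem (P n) r ≡ true → isElem (P n) s ≡ true → pos r ≡ pos s → r ≡ s
  pos-injective (inj₁ u)       (inj₁ v)       _ _ eq = cong inj₁ (toℕ-injective (*-cancelˡ-≡ (toℕ u) (toℕ v) 2 eq))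
  pos-injective (inj₁ u)       (inj₂ (k , _)) _ _ eq = ⊥-elim (even≢odd (toℕ u) (toℕ k) eq)
  pos-injective (inj₂ (i , _)) (inj₁ v)       _ _ eq = ⊥-elim (even≢odd (toℕ v) (toℕ i) (sym eq))
  pos-injective (inj₂ (i , j)) (inj₂ (k , l)) e-valid f-valid eq = cong₂ (λ a b → inj₂ (a , b)) i≡k
    (toℕ-injective (trans (edge-suc i j e-valid) (trans (cong (suc ∘ toℕ) i≡k) (sym (edge-suc k l f-valid)))))
    where
    i≡k : i ≡ k
    i≡k = toℕ-injective (*-cancelˡ-≡ (toℕ i) (toℕ k) 2 (suc-injective eq))

dtR-P≤4 : ∀ n {r} → r ∈ elemsRaw (P n) → dtR (P n) r ≤ 4
dtR-P≤4 n {r} r∈ = Fin-injection⇒≤length _ F F-injective λ a →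
  Near⇒∈ (adjacent⇒near r (lookup N a) (∈-elemsRaw⁻ (P n) r∈) (valid a) (adjacent a))
  where
  N : List (RawElem (P n))
  N = filterᵇ (adjR (P n) r) (elemsRaw (P n))
  valid : ∀ a → isElem (P n) (lookup N a) ≡ true
  valid a = ∈-elemsRaw⁻ (P n) (proj₁ (∈-filter⁻ (T? ∘ adjR (P n) r) {xs = elemsRaw (P n)} (∈-lookup {xs = N} a)))
  adjacent : ∀ a → adjR (P n) r (lookup N a) ≡ true
  adjacent a = Equivalence.to T-≡ (proj₂ (∈-filter⁻ (T? ∘ adjR (P n) r) {xs = elemsRaw (P n)} (∈-lookup {xs = N} a)))
  F : Fin (length N) → ℕ
  F a = suc (suc (pos (lookup N a)))
  F-injective : ∀ {a b} → F a ≡ F b → a ≡ b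
  F-injective {a} {b} eq = Unique-lookup-injective (Uniqueₚ.filter⁺ (T? ∘ adjR (P n) r) (elemsRaw-unique (P n)))
    (pos-injective _ _ (valid a) (valid b) (suc-injective (suc-injective eq)))

mt-P≤5 : ∀ n → mt (P n) ≤ 5
mt-P≤5 n = mtAux-≤ (P n) 0 (All-resp-↭ (↭-sym (sortDesc-↭ degrees)) (All.tabulate degree≤4))
  where
  degrees : List ℕ
  degrees = map (dtR (P n)) (elemsRaw (P n))
  degree≤4 : ∀ {d} → d ∈ degrees → d ≤ 4
  degree≤4 d∈ with ∈-map⁻ (dtR (P n)) d∈
  ... | r , r∈ , refl = dtR-P≤4 n r∈

pos-prefix : ∀ m k r → isElem (P m) r ≡ true → pos (Embedding.raw (prefix m k) r) ≡ pos r
pos-prefix m k (inj₁ v)       _     = cong (2 *_) (toℕ-↑ˡ v k)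
pos-prefix m k (inj₂ (i , j)) valid =
  trans (cong (suc ∘ (2 *_) ∘ toℕ ∘ proj₁) (ordered-< i↑<j↑)) (cong (suc ∘ (2 *_)) (toℕ-↑ˡ i k))
  where
  i↑<j↑ : toℕ (i ↑ˡ k) < toℕ (j ↑ˡ k)
  i↑<j↑ = subst₂ _<_ (sym (toℕ-↑ˡ i k)) (sym (toℕ-↑ˡ j k)) (proj₁ (isEdge⁻ (P m) valid))

-- Colouring a path by position

%-≡⇒∣ : ∀ m d k .{{_ : NonZero k}} → m % k ≡ (d + m) % k → k ∣ d
%-≡⇒∣ m d k eq = ∣m+n∣m⇒∣n (subst (k ∣_) quotients (n∣m*n ((d + m) / k))) (n∣m*n (m / k))
  where
  open ≡-Reasoning
  quotients : (d + m) / k * k ≡ m / k * k + d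
  quotients = +-cancelˡ-≡ (m % k) _ _ (begin
    m % k + (d + m) / k * k        ≡⟨ cong (_+ (d + m) / k * k) eq ⟩
    (d + m) % k + (d + m) / k * k  ≡⟨ m≡m%n+[m/n]*n (d + m) k ⟨
    d + m                          ≡⟨ cong (d +_) (m≡m%n+[m/n]*n m k) ⟩
    d + (m % k + m / k * k)        ≡⟨ +-comm d _ ⟩
    m % k + m / k * k + d          ≡⟨ +-assoc (m % k) _ d ⟩
    m % k + (m / k * k + d)        ∎)

mod≡⇒%≡ : ∀ {m n k} .{{_ : NonZero k}} → m mod k ≡ n mod k → m % k ≡ n % k
mod≡⇒%≡ eq = trans (sym (toℕ-fromℕ< _)) (trans (cong toℕ eq) (toℕ-fromℕ< _))

Step⇒mod≢ : ∀ {k} .{{_ : NonZero k}} → 3 ≤ k → ∀ {p q} → Step p q → p mod k ≢ q mod k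
Step⇒mod≢ 3≤k {p} one eq with ≤-trans 3≤k (∣⇒≤ (%-≡⇒∣ p 1 _ (mod≡⇒%≡ eq)))
... | s≤s ()
Step⇒mod≢ 3≤k {p} two eq with ≤-trans 3≤k (∣⇒≤ (%-≡⇒∣ p 2 _ (mod≡⇒%≡ eq)))
... | s≤s (s≤s ())

Near⇒mod≢ : ∀ {k} .{{_ : NonZero k}} → 3 ≤ k → ∀ {p q} → Near p q → p mod k ≢ q mod k
Near⇒mod≢ 3≤k (inj₁ step) = Step⇒mod≢ 3≤k step
Near⇒mod≢ 3≤k (inj₂ step) = Step⇒mod≢ 3≤k step ∘ sym

positionColour : ∀ n k .{{_ : NonZero k}} → Elem (P n) → Fin k
positionColour n k x = pos (proj₁ x) mod k

positionColour-proper : ∀ n k .{{_ : NonZero k}} → 3 ≤ k →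
  ∀ x y → Adjacent (P n) x y → positionColour n k x ≢ positionColour n k y
positionColour-proper n k 3≤k (r , r-valid) (s , s-valid) r~s = Near⇒mod≢ 3≤k (adjacent⇒near r s r-valid s-valid r~s)

positionBColouring : ∀ n k .{{_ : NonZero k}} → 3 ≤ k →
  BChromaticInEveryClass (P n) k (positionColour n k) → TotalBColouring (P n) k
positionBColouring n k 3≤k = bColouring (positionColour n k) (positionColour-proper n k 3≤k)

P≥5-bColouring : ∀ k → TotalBColouring (P (5 + k)) 5
P≥5-bColouring k = positionBColouring (5 + k) 5 (s≤s (s≤s (s≤s z≤n)))
  (bChromaticInEveryClass-transport (Embedding.elem (prefix 5 k)) (Embedding.elem-adjacent (prefix 5 k)) colour-prefix
    (from-yes (bChromaticInEveryClass? (P 5) (positionColour 5 5))))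
  where
  colour-prefix : ∀ x → positionColour (5 + k) 5 (Embedding.elem (prefix 5 k) x) ≡ positionColour 5 5 x
  colour-prefix (r , valid) = cong (_mod 5) (pos-prefix 5 k r valid)

P1-no-adjacency : ∀ x y → ¬ Adjacent (P 1) x y
P1-no-adjacency (inj₁ Fin.zero , _) (inj₁ Fin.zero , _) ()
P1-no-adjacency (inj₁ Fin.zero , _) (inj₂ (Fin.zero , Fin.zero) , ()) _
P1-no-adjacency (inj₂ (Fin.zero , Fin.zero) , ()) _ _

-- For n = 1, 2, 3, 4, mt (P n) evaluates to 1, 3, 3, 4.
P-bColouring : ∀ n → 1 ≤ n → TotalBColouring (P n) (mt (P n))
P-bColouring 1 _ = bColouring (positionColour 1 1) (λ x y x~y → ⊥-elim (P1-no-adjacency x y x~y))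
  (from-yes (bChromaticInEveryClass? (P 1) (positionColour 1 1)))
P-bColouring 2 _ = positionBColouring 2 3 ≤-refl (from-yes (bChromaticInEveryClass? (P 2) (positionColour 2 3)))
P-bColouring 3 _ = positionBColouring 3 3 ≤-refl (from-yes (bChromaticInEveryClass? (P 3) (positionColour 3 3)))
P-bColouring 4 _ = positionBColouring 4 4 (n≤1+n 3) (from-yes (bChromaticInEveryClass? (P 4) (positionColour 4 4)))
P-bColouring (suc (suc (suc (suc (suc k))))) _ =
  subst (TotalBColouring (P (5 + k)))
    (≤-antisym (bColouring⇒≤mt (P (5 + k)) 5 (P≥5-bColouring k)) (mt-P≤5 (5 + k)))
    (P≥5-bColouring k)

proposition2 : (G : Graph) → 1 ≤ Graph.n G → IsPath G → IsPhiT G (mt G)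
proposition2 G 1≤n path =
  subst (TotalBColouring G) mt-≡ (bColouring-pullback (P-bColouring (Graph.n G) 1≤n)) , bColouring⇒≤mt G
  where
  open Isomorphism (IsPath⇒≅P G path)
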